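{- Let $G_\tau$ be a bidirected graph and $\mathrm{Rt}(G_\tau)$ a transitive reduction of $G_\tau$. Then $\mathrm{Ft}(\mathrm{Rt}(G_\tau))=\mathrm{Ft}(G_\tau)$.
   Context: A graph $G=(V,E)$ is finite, with loops and multiple edges allowed. A half-edge is a pair $(e,x)$ with $e$ incident with $x$ (a loop has two half-edges at its vertex). A bidirected graph $G_\tau=(V,E;\tau)$ is a graph with a map $\tau$ assigning $+1$ or $-1$ to every half-edge; an edge with ends $x,y$ and $\tau(e,x)=\alpha,\tau(e,y)=\beta$ is written $\{x^\alpha,y^\beta\}$. A partial graph of $G_\tau$ is $(V,F;\tau|_F)$ with $F\subseteq E$. A chain is $x_0,e_1,x_1,\ldots,e_k,x_k$ where $e_i$ has ends $x_{i-1},x_i$; when $e_i$ is traversed from $x_{i-1}$ to $x_i$, $\tau(e_i,x_{i-1}),\tau(e_i,x_i)$ denote the values at the corresponding half-edges. For $\alpha,\beta\in\{\pm1\}$ a b-walk from $x^\alpha$ to $y^\beta$ is a chain $x=x_0,e_1,\ldots,e_k,x_k=y$ with $k\ge1$, $\tau(e_1,x_0)=\alpha$, $\tau(e_k,x_k)=\beta$ and $\tau(e_i,x_i)+\tau(e_{i+1},x_i)=0$ for $1\le i\le k-1$. A b-path from $x^\alpha$ to $y^\beta$ is a b-walk from $x^\alpha$ to $y^\beta$ minimal with these properties (no b-walk from $x^\alpha$ to $y^\beta$ has as edge sequence a proper subsequence, in the same order, of its edge sequence); $x=y$ allowed. The transitive closure $\mathrm{Ft}(G_\tau)$ is the bidirected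 graph on $V$ whose edges are those of $G_\tau$ together with an edge $\{x^\alpha,y^\beta\}$ (a loop if $x=y$) for every $x^\alpha,y^\beta$ such that $G_\tau$ has a b-path from $x^\alpha$ to $y^\beta$. For a partial graph $H_\tau$ of $G_\tau$, $\mathrm{ft}(G_\tau;H_\tau)$ (the transitive closure of $H_\tau$ in $G_\tau$) is the partial graph of $G_\tau$ whose edges are the edges of $G_\tau$ that are edges of $H_\tau$ or are of the form $\{x^\alpha,y^\beta\}$ with a b-path from $x^\alpha$ to $y^\beta$ in $H_\tau$. A transitive reduction $\mathrm{Rt}(G_\tau)$ of $G_\tau$ is a minimal partial graph $R$ of $G_\tau$ with $\mathrm{ft}(G_\tau;R)=G_\tau$ (it need not be unique). -}

module Defs where

open import Data.Nat using (ℕ)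
open import Data.Fin using (Fin)
open import Data.Bool using (Bool; true; false)
open import Data.List using (List; []; _∷_)
open import Data.Product using (Σ; _×_; ∃)
open import Data.Sum using (_⊎_)
open import Relation.Nullary using (¬_)
open import Relation.Binary.PropositionalEquality using (_≡_; _≢_)
open import Data.Fin.Subset using (Subset; _∈_; _⊂_; ⊤)
import Data.List.Relation.Binary.Sublist.Propositional as SL
open import Function.Bundles using (_⇔_)

data Sign : Set where
  plus minus : Sign

neg : Sign → Sign
neg plus  = minus
neg minus = plus

-- Edge e has two half-edges, stored as end₁/end₂ with signs τ₁/τ₂
-- (a loop has end₁ e ≡ end₂ e, and still two distinct half-edges).
record BiGraph (n m : ℕ) : Set where
  field
    end₁ end₂ : Fin m → Fin n
    τ₁ τ₂     : Fin m → Sign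

module _ {n m : ℕ} (G : BiGraph n m) where
  open BiGraph G

  src tgt : Fin m → Bool → Fin n
  src e true  = end₁ e
  src e false = end₂ e
  tgt e true  = end₂ e
  tgt e false = end₁ e

  sgnSrc sgnTgt : Fin m → Bool → Sign
  sgnSrc e true  = τ₁ e
  sgnSrc e false = τ₂ e
  sgnTgt e true  = τ₂ e
  sgnTgt e false = τ₁ e

  -- Walk S x α y β es : a b-walk from x^α to y^β in the partial graph with
  -- edge set S, with edge sequence es (k ≥ 1 steps).
  data Walk (S : Subset m) : Fin n → Sign → Fin n → Sign → List (Fin m) → Set where
    one  : ∀ e d → e ∈ S →
           Walk S (src e d) (sgnSrc e d) (tgt e d) (sgnTgt e d) (e ∷ [])
    step : ∀ e d {y β es} → e ∈ S →
           Walk S (tgt e d) (neg (sgnTgt e d)) y β es →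
           Walk S (src e d) (sgnSrc e d) y β (e ∷ es)

  BPath : Subset m → Fin n → Sign → Fin n → Sign → List (Fin m) → Set
  BPath S x α y β es =
    Walk S x α y β es ×
    (∀ es′ → es′ SL.⊆ es → es′ ≢ es → ¬ Walk S x α y β es′)

  EdgeIs : Fin m → Fin n → Sign → Fin n → Sign → Set
  EdgeIs e x α y β =
    Σ Bool λ d → src e d ≡ x × sgnSrc e d ≡ α × tgt e d ≡ y × sgnTgt e d ≡ β

  -- Ft of the partial graph (V,S;τ|S) contains an edge {x^α,y^β} (either
  -- an original edge of S, or an added one coming from a b-path in S,
  -- from x^α to y^β or from y^β to x^α since {x^α,y^β} is unordered).
  FtHas : Subset m → Fin n → Sign → Fin n → Sign → Set
  FtHas S x α y β =
    (Σ (Fin m) λ e → e ∈ S × EdgeIs e x α y β)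
    ⊎ (∃ λ es → BPath S x α y β es)
    ⊎ (∃ λ es → BPath S y β x α es)

  ftIsWhole : Subset m → Set
  ftIsWhole R =
    ∀ e → e ∈ R ⊎
      (Σ Bool λ d → ∃ λ es →
         BPath R (src e d) (sgnSrc e d) (tgt e d) (sgnTgt e d) es)

  IsTransitiveReduction : Subset m → Set
  IsTransitiveReduction R =
    ftIsWhole R × (∀ R′ → R′ ⊂ R → ¬ ftIsWhole R′)

  SameFt : Subset m → Subset m → Set
  SameFt S T = ∀ x α y β → FtHas S x α y β ⇔ FtHas T x α y β

-- A b-walk in G can be rerouted through R: each edge of G that is not in R
-- is the edge of some b-path of R, so replacing every edge by such a b-path
-- turns a b-walk of G into one of R with the same end data. Conversely a
-- b-walk of R is one of G. Hence both sides reduce to the statement that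
-- Ft(S) contains {x^α, y^β} iff S has a b-walk from x^α to y^β: b-walks can
-- be reversed, and every b-walk contains, as a subsequence, a b-path with the
-- same ends, found by minimising over the decidable property of being a walk.
module Submission where

open import Defs
open import Data.Nat using (ℕ; _<_; s≤s)
open import Data.Nat.Induction using (<-wellFounded)
open import Data.Fin using (Fin) renaming (_≟_ to _≟ᶠ_)
open import Data.Fin.Subset using (Subset; ⊤; _∈_; _⊆_)
open import Data.Fin.Subset.Properties using (⊆⊤; _∈?_)
open import Data.Bool using (Bool; true; false)
open import Data.List using (List; []; _∷_; _++_; length)
import Data.List.Properties as List
open import Data.List.Relation.Binary.Sublist.Propositional using (_∷ʳ_; _∷_)
  renaming (_⊆_ to _⊑_; [] to []ˢ)
open import Data.List.Relation.Binary.Sublist.Propositional.Properties using (length-mono-≤)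
open import Data.Product using (Σ; _×_; ∃; _,_; proj₂; map₂)
open import Data.Sum using (_⊎_; inj₁; inj₂)
open import Induction.WellFounded using (Acc; acc)
open import Relation.Nullary using (¬_; Dec; yes; no; contradiction)
open import Relation.Nullary.Decidable using (_×-dec_; _⊎-dec_; map′; ¬?)
open import Relation.Unary using (Decidable)
open import Relation.Binary.PropositionalEquality using (_≡_; _≢_; refl; sym; cong; subst)
open import Function.Bundles using (_⇔_; mk⇔; Equivalence)

_≟ˢ_ : (α β : Sign) → Dec (α ≡ β)
plus  ≟ˢ plus  = yes refl
plus  ≟ˢ minus = no λ ()
minus ≟ˢ plus  = no λ ()
minus ≟ˢ minus = yes refl

neg-involutive : ∀ α → neg (neg α) ≡ α
neg-involutive plus  = refl
neg-involutive minus = refl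

Σ-Bool? : {P : Bool → Set} → Dec (P true) → Dec (P false) → Dec (Σ Bool P)
Σ-Bool? (yes p) _       = yes (true , p)
Σ-Bool? (no ¬p) (yes q) = yes (false , q)
Σ-Bool? (no ¬p) (no ¬q) = no λ { (true , p) → ¬p p ; (false , q) → ¬q q }

module _ {A : Set} where

  MinimalSublist : (List A → Set) → List A → Set
  MinimalSublist P ys = ∀ zs → zs ⊑ ys → zs ≢ ys → ¬ P zs

  length-<-of-proper : ∀ {xs ys : List A} → xs ⊑ ys → xs ≢ ys → length xs < length ys
  length-<-of-proper []ˢ        xs≢ys = contradiction refl xs≢ys
  length-<-of-proper (y ∷ʳ xs⊑ys) _   = s≤s (length-mono-≤ xs⊑ys)
  length-<-of-proper (refl ∷ xs⊑ys) xs≢ys =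
    s≤s (length-<-of-proper xs⊑ys (λ eq → xs≢ys (cong (_ ∷_) eq)))

  -- The predicate is generalised so that the cons case can recurse on P ∘ (x ∷_).
  ∃-sublist? : ∀ {P : List A → Set} → Decidable P →
               ∀ xs → Dec (∃ λ ys → ys ⊑ xs × P ys)
  ∃-sublist? P? [] = map′ (λ p → [] , []ˢ , p) (λ { (.[] , []ˢ , p) → p }) (P? [])
  ∃-sublist? {P} P? (x ∷ xs) = map′ from to
    (∃-sublist? P? xs ⊎-dec ∃-sublist? (λ ys → P? (x ∷ ys)) xs)
    where
    from : (∃ λ ys → ys ⊑ xs × P ys) ⊎ (∃ λ ys → ys ⊑ xs × P (x ∷ ys)) →
           ∃ λ ys → ys ⊑ x ∷ xs × P ys
    from (inj₁ (ys , ys⊑xs , p)) = ys , x ∷ʳ ys⊑xs , p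
    from (inj₂ (ys , ys⊑xs , p)) = x ∷ ys , refl ∷ ys⊑xs , p
    to : (∃ λ ys → ys ⊑ x ∷ xs × P ys) →
         (∃ λ ys → ys ⊑ xs × P ys) ⊎ (∃ λ ys → ys ⊑ xs × P (x ∷ ys))
    to (ys , x ∷ʳ ys⊑xs , p)       = inj₁ (ys , ys⊑xs , p)
    to (_ ∷ ys , refl ∷ ys⊑xs , p) = inj₂ (ys , ys⊑xs , p)

  module _ (_≟_ : (x y : A) → Dec (x ≡ y)) {P : List A → Set} (P? : Decidable P) where

    minimal-sublist : ∀ xs → P xs → ∃ λ ys → P ys × MinimalSublist P ys
    minimal-sublist xs = go xs (<-wellFounded (length xs))
      where
      go : ∀ xs → Acc _<_ (length xs) → P xs → ∃ λ ys → P ys × MinimalSublist P ys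
      go xs (acc rec) p
        with ∃-sublist? (λ ys → ¬? (List.≡-dec _≟_ ys xs) ×-dec P? ys) xs
      ... | yes (ys , ys⊑xs , ys≢xs , q) = go ys (rec (length-<-of-proper ys⊑xs ys≢xs)) q
      ... | no ¬smaller = xs , p , λ zs zs⊑xs zs≢xs q → ¬smaller (zs , zs⊑xs , zs≢xs , q)

module _ {n m : ℕ} (G : BiGraph n m) where

  edgeIs? : ∀ e x α y β → Dec (EdgeIs G e x α y β)
  edgeIs? e x α y β = Σ-Bool? (endsAre? true) (endsAre? false)
    where
    endsAre? : ∀ d → Dec (src G e d ≡ x × sgnSrc G e d ≡ α × tgt G e d ≡ y × sgnTgt G e d ≡ β)
    endsAre? d = (src G e d ≟ᶠ x) ×-dec (sgnSrc G e d ≟ˢ α) ×-dec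
                 (tgt G e d ≟ᶠ y) ×-dec (sgnTgt G e d ≟ˢ β)

  Reaches : Subset m → Fin n → Sign → Fin n → Sign → Set
  Reaches S x α y β = ∃ (Walk G S x α y β)

  module _ {S : Subset m} where

    walk-[_]⇔ : ∀ {x α y β} e → Walk G S x α y β (e ∷ []) ⇔ (e ∈ S × EdgeIs G e x α y β)
    walk-[ e ]⇔ = mk⇔ to from
      where
      to : ∀ {x α y β} → Walk G S x α y β (e ∷ []) → e ∈ S × EdgeIs G e x α y β
      to (one e d e∈S) = e∈S , d , refl , refl , refl , refl
      to (step e d e∈S ())
      from : ∀ {x α y β} → e ∈ S × EdgeIs G e x α y β → Walk G S x α y β (e ∷ [])
      from (e∈S , d , refl , refl , refl , refl) = one e d e∈S

    walk-∷⇔ : ∀ {x α y β} e f fs →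
              Walk G S x α y β (e ∷ f ∷ fs) ⇔
              (e ∈ S × Σ Bool λ d → src G e d ≡ x × sgnSrc G e d ≡ α ×
                                     Walk G S (tgt G e d) (neg (sgnTgt G e d)) y β (f ∷ fs))
    walk-∷⇔ e f fs = mk⇔ (λ { (step e d e∈S w) → e∈S , d , refl , refl , w })
                         (λ { (e∈S , d , refl , refl , w) → step e d e∈S w })

    walk? : ∀ x α y β → Decidable (Walk G S x α y β)
    walk? x α y β [] = no λ ()
    walk? x α y β (e ∷ []) =
      map′ (Equivalence.from walk-[ e ]⇔) (Equivalence.to walk-[ e ]⇔)
        ((e ∈? S) ×-dec edgeIs? e x α y β)
    walk? x α y β (e ∷ f ∷ fs) =
      map′ (Equivalence.from (walk-∷⇔ e f fs)) (Equivalence.to (walk-∷⇔ e f fs))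
        ((e ∈? S) ×-dec Σ-Bool?
          (leaves? true  (walk? (tgt G e true)  (neg (sgnTgt G e true))  y β (f ∷ fs)))
          (leaves? false (walk? (tgt G e false) (neg (sgnTgt G e false)) y β (f ∷ fs))))
      where
      leaves? : ∀ d → Dec (Walk G S (tgt G e d) (neg (sgnTgt G e d)) y β (f ∷ fs)) →
                Dec (src G e d ≡ x × sgnSrc G e d ≡ α ×
                     Walk G S (tgt G e d) (neg (sgnTgt G e d)) y β (f ∷ fs))
      leaves? d rest? = (src G e d ≟ᶠ x) ×-dec (sgnSrc G e d ≟ˢ α) ×-dec rest?

    walk-++ : ∀ {x α y β z γ es fs} → Walk G S x α y β es →
              Walk G S y (neg β) z γ fs → Walk G S x α z γ (es ++ fs)
    walk-++ (one e d e∈S)    w′ = step e d e∈S w′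
    walk-++ (step e d e∈S w) w′ = step e d e∈S (walk-++ w w′)

    reaches-trans : ∀ {x α y β z γ} → Reaches S x α y β →
                    Reaches S y (neg β) z γ → Reaches S x α z γ
    reaches-trans (_ , w) (_ , w′) = _ , walk-++ w w′

    reaches-edge : ∀ {e} d → e ∈ S →
                   Reaches S (src G e d) (sgnSrc G e d) (tgt G e d) (sgnTgt G e d)
    reaches-edge d e∈S = _ , one _ d e∈S

    reaches-edge-reverse : ∀ {e} d → e ∈ S →
                           Reaches S (tgt G e d) (sgnTgt G e d) (src G e d) (sgnSrc G e d)
    reaches-edge-reverse true  e∈S = reaches-edge false e∈S
    reaches-edge-reverse false e∈S = reaches-edge true e∈S

    -- Reversing the tail ends at y^(neg (neg β)), hence the involution.
    walk-reverse : ∀ {x α y β es} → Walk G S x α y β es → Reaches S y β x α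
    walk-reverse (one e d e∈S) = reaches-edge-reverse d e∈S
    walk-reverse (step e d e∈S w) =
      reaches-trans (walk-reverse w)
        (subst (λ γ → Reaches S (tgt G e d) γ (src G e d) (sgnSrc G e d))
               (sym (neg-involutive _)) (reaches-edge-reverse d e∈S))

    reaches⇒bPath : ∀ {x α y β} → Reaches S x α y β → ∃ (BPath G S x α y β)
    reaches⇒bPath (es , w) = minimal-sublist _≟ᶠ_ (walk? _ _ _ _) es w

    ftHas⇔reaches : ∀ {x α y β} → FtHas G S x α y β ⇔ Reaches S x α y β
    ftHas⇔reaches = mk⇔ to (λ r → inj₂ (inj₁ (reaches⇒bPath r)))
      where
      to : ∀ {x α y β} → FtHas G S x α y β → Reaches S x α y β
      to (inj₁ (e , e∈S , d , refl , refl , refl , refl)) = reaches-edge d e∈S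
      to (inj₂ (inj₁ (es , w , _)))                     = es , w
      to (inj₂ (inj₂ (es , w , _)))                     = walk-reverse w

  walk-mono : ∀ {S T x α y β es} → S ⊆ T → Walk G S x α y β es → Walk G T x α y β es
  walk-mono S⊆T (one e d e∈S)    = one e d (S⊆T e∈S)
  walk-mono S⊆T (step e d e∈S w) = step e d (S⊆T e∈S) (walk-mono S⊆T w)

  module _ {R : Subset m} (ft-whole : ftIsWhole G R) where

    reaches-along-edge : ∀ e d →
      Reaches R (src G e d) (sgnSrc G e d) (tgt G e d) (sgnTgt G e d)
    reaches-along-edge e d with ft-whole e
    ... | inj₁ e∈R = reaches-edge d e∈R
    reaches-along-edge e true  | inj₂ (true  , es , w , _) = es , w
    reaches-along-edge e false | inj₂ (false , es , w , _) = es , w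
    reaches-along-edge e true  | inj₂ (false , es , w , _) = walk-reverse w
    reaches-along-edge e false | inj₂ (true  , es , w , _) = walk-reverse w

    reroute : ∀ {S x α y β es} → Walk G S x α y β es → Reaches R x α y β
    reroute (one e d _)    = reaches-along-edge e d
    reroute (step e d _ w) = reaches-trans (reaches-along-edge e d) (reroute w)

proposition35 : ∀ {n m : ℕ} (G : BiGraph n m) (R : Subset m) →
    IsTransitiveReduction G R → SameFt G R ⊤
proposition35 G R (ft-whole , _) x α y β = mk⇔
  (λ h → from (ftHas⇔reaches G) (map₂ (walk-mono G ⊆⊤) (to (ftHas⇔reaches G) h)))
  (λ h → from (ftHas⇔reaches G) (reroute G ft-whole (proj₂ (to (ftHas⇔reaches G) h))))
  where open Equivalence
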